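{- Let $N$ be a positive integer, let $x\in\{ -1,1\}^{\mathbb{Z}/N\mathbb{Z}}$ with $\Sigma(x)=0$ and $y\in\{ -1,1\}^{\mathbb{Z}}$, and let $L$ be a hitomezashi loop in $\mathrm{Cloth}_{\mathbb{Z}\times\mathbb{Z}/N\mathbb{Z}}(x,y)$ with homology class $1$ (resp. $-1$). Let $\{(u,v): m\le u\le M\}$ be the bounding cylinder of $L$. Then there exist integers $m\le m'<M'\le M$ such that $y_{m'},y_{m'+1},\ldots,y_{M'}$ is minimally positively overflowing (resp. minimally negatively overflowing).
   Context: Oriented hitomezashi pattern: $\mathrm{Cloth}_{\mathbb{Z}\times\mathbb{Z}/N\mathbb{Z}}(x,y)$ is the directed graph on vertex set $\mathbb{Z}\times\mathbb{Z}/N\mathbb{Z}$ in which, for each $(i,j)$, the (horizontal) edge between $(i,j)$ and $(i+1,j)$ is oriented $(i,j)\to(i+1,j)$ if $x_j=1$ and $(i+1,j)\to(i,j)$ if $x_j=-1$, and the (vertical) edge between $(i,j)$ and $(i,j+1)$ is oriented $(i,j)\to(i,j+1)$ if $y_i=1$ and $(i,j+1)\to(i,j)$ if $y_i=-1$. A hitomezashi loop is a closed directed circuit following the orientations and alternating between horizontal and vertical edges. Its homology class is $\Delta y/N$, where $\Delta y$ is the number of its edges of the form $(i,j)\to(i,j+1)$ minus the number of the form $(i,j+1)\to(i,j)$. The bounding cylinder of $L$ is the smallest set of the form $\{(u,v): m\le u\le M\}$ containing $L$. Sums: for $z\in\{ -1,1\}^{\mathbb{Z}}$ and $a\le b$,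 $\Sigma_a^b(z)=\sum_{a\le i\le b}z_i$, $\Sigma_{b+1}^b(z)=0$, $\Sigma_a^b(z)=-\Sigma_{b+1}^{a-1}(z)$ for $a>b+1$. For $x$ indexed by $\mathbb{Z}/N\mathbb{Z}$: $\Sigma(x)=\sum_{i}x_i$, $\Sigma_a^b(x)=\Sigma_a^b(\tilde x)$ with $\tilde x_i=x_{i\bmod N}$; when $\Sigma(x)=0$, $r(x)=\sup\{\Sigma_a^b(x):a\le b+1\}=-\inf\{\Sigma_a^b(x):a\le b+1\}$. A consecutive subsequence $y_m,\ldots,y_M$ is positively overflowing if $\Sigma_m^M(y)>r(x)$, negatively overflowing if $\Sigma_m^M(y)<-r(x)$, and minimally positively (resp. negatively) overflowing if it is positively (resp. negatively) overflowing and no $y_{m'},\ldots,y_{M'}$ with $m<m'\le M'<M$ is positively (resp. negatively) overflowing. -}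

module Defs where

open import Data.Nat as ℕ using (ℕ; NonZero)
open import Data.Nat.DivMod using (_mod_)
open import Data.Integer as ℤ using (ℤ; +_; _+_; _-_; -_; _≤_; _<_; _≤?_; ∣_∣; _%ℕ_)
open import Data.Fin using (Fin; toℕ)
open import Data.List using (List; []; _∷_; _++_; [_]; map; foldr; allFin)
open import Data.List.Relation.Unary.Linked using (Linked)
open import Data.List.Relation.Unary.All using (All)
open import Data.List.Relation.Unary.Any using (Any)
open import Data.List.Relation.Unary.Unique.Propositional using (Unique)
open import Data.Unit using (⊤)
open import Data.Empty using (⊥)
open import Data.Product using (_×_; _,_; proj₁; Σ; ∃; ∃-syntax)
open import Relation.Nullary using (¬_; yes; no)
open import Relation.Binary.PropositionalEquality using (_≡_; _≢_)

sumℤ : List ℤ → ℤ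
sumℤ = foldr _+_ (+ 0)

data Sign : Set where
  pos neg : Sign

sgn : Sign → ℤ
sgn pos = + 1
sgn neg = - (+ 1)

module _ (N : ℕ) .{{_ : NonZero N}} where

  toZN : ℤ → Fin N
  toZN z = (z %ℕ N) mod N

sumFrom : (ℤ → Sign) → ℤ → ℕ → ℤ
sumFrom z a ℕ.zero    = + 0
sumFrom z a (ℕ.suc n) = sgn (z a) + sumFrom z (a + + 1) n

-- Σ_a^b(z) = Σ_{a ≤ i ≤ b} z_i  if a ≤ b+1  (empty sum 0 when a = b+1),
-- and Σ_a^b(z) = - Σ_{b+1}^{a-1}(z)  if a > b+1.
Σ[_]_to_ : (ℤ → Sign) → ℤ → ℤ → ℤ
Σ[ z ] a to b with a ≤? b + + 1
... | yes _ = sumFrom z a ∣ (b + + 1) - a ∣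
... | no  _ = - sumFrom z (b + + 1) ∣ a - (b + + 1) ∣

module _ (N : ℕ) .{{_ : NonZero N}} (x : Fin N → Sign) where

  xper : ℤ → Sign
  xper i = x (toZN N i)

  totalSum : ℤ
  totalSum = sumℤ (map (λ j → sgn (x j)) (allFin N))

  Σx_to_ : ℤ → ℤ → ℤ
  Σx a to b = Σ[ xper ] a to b

  IsR : ℤ → Set
  IsR r = (∀ a b → a ≤ b + + 1 → Σx a to b ≤ r)
        × (∃[ a ] ∃[ b ] (a ≤ b + + 1 × Σx a to b ≡ r))

  PosOverflowing : (ℤ → Sign) → ℤ → ℤ → Set
  PosOverflowing y m M = ∀ r → IsR r → r < Σ[ y ] m to M

  NegOverflowing : (ℤ → Sign) → ℤ → ℤ → Set
  NegOverflowing y m M = ∀ r → IsR r → Σ[ y ] m to M < - r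

  MinPosOverflowing : (ℤ → Sign) → ℤ → ℤ → Set
  MinPosOverflowing y m M =
    PosOverflowing y m M ×
    (∀ m' M' → m < m' → m' ≤ M' → M' < M → ¬ PosOverflowing y m' M')

  MinNegOverflowing : (ℤ → Sign) → ℤ → ℤ → Set
  MinNegOverflowing y m M =
    NegOverflowing y m M ×
    (∀ m' M' → m < m' → m' ≤ M' → M' < M → ¬ NegOverflowing y m' M')

data Kind : Set where
  hor ver : Kind

-- A step along an edge: its kind and the sign of the coordinate change
-- (+1: (i,j) → (i+1,j) resp. (i,j) → (i,j+1); -1: the reverse direction).
record Move : Set where
  constructor mv
  field
    kind : Kind
    dir  : Sign
open Move public

module _ (N : ℕ) .{{_ : NonZero N}} where

  Vertex : Set
  Vertex = ℤ × Fin N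

  -- an (undirected) edge: horizontal edge (hor , i , j) joins (i,j),(i+1,j);
  -- vertical edge (ver , i , j) joins (i,j),(i,j+1)
  Edge : Set
  Edge = Kind × ℤ × Fin N

  shift : Vertex → Move → Vertex
  shift (i , j) (mv hor d) = (i + sgn d , j)
  shift (i , j) (mv ver d) = (i , toZN N (+ toℕ j + sgn d))

  edgeOf : Vertex → Move → Edge
  edgeOf (i , j) (mv hor pos) = (hor , i , j)
  edgeOf (i , j) (mv hor neg) = (hor , i - + 1 , j)
  edgeOf (i , j) (mv ver pos) = (ver , i , j)
  edgeOf (i , j) (mv ver neg) = (ver , i , toZN N (+ toℕ j - + 1))

  -- the move follows the orientation of its edge:
  --  edge (i,j)–(i+1,j) is oriented (i,j)→(i+1,j) iff x_j = 1,
  --  edge (i,j)–(i,j+1) is oriented (i,j)→(i,j+1) iff y_i = 1.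
  -- Moving from (i,j) in direction d horizontally uses an edge in row j,
  -- which is legal iff x_j = d; similarly vertically iff y_i = d.
  Allowed : (Fin N → Sign) → (ℤ → Sign) → Vertex → Move → Set
  Allowed x y (i , j) (mv hor d) = x j ≡ d
  Allowed x y (i , j) (mv ver d) = y i ≡ d

  ValidWalk : (Fin N → Sign) → (ℤ → Sign) → Vertex → List Move → Set
  ValidWalk x y v []       = ⊤
  ValidWalk x y v (m ∷ ms) = Allowed x y v m × ValidWalk x y (shift v m) ms

  endpoint : Vertex → List Move → Vertex
  endpoint v []       = v
  endpoint v (m ∷ ms) = endpoint (shift v m) ms

  vertices : Vertex → List Move → List Vertex
  vertices v []       = []
  vertices v (m ∷ ms) = v ∷ vertices (shift v m) ms

  edges : Vertex → List Move → List Edge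
  edges v []       = []
  edges v (m ∷ ms) = edgeOf v m ∷ edges (shift v m) ms

  CyclicAlternating : List Move → Set
  CyclicAlternating []       = ⊥
  CyclicAlternating (m ∷ ms) = Linked (λ a b → kind a ≢ kind b) ((m ∷ ms) ++ [ m ])

  vstep : Move → ℤ
  vstep (mv hor _) = + 0
  vstep (mv ver d) = sgn d

  Δy : List Move → ℤ
  Δy ms = sumℤ (map vstep ms)

  record HitomezashiLoop (x : Fin N → Sign) (y : ℤ → Sign) : Set where
    field
      start   : Vertex
      moves   : List Move
      valid   : ValidWalk x y start moves
      closed  : endpoint start moves ≡ start
      alter   : CyclicAlternating moves
      circuit : Unique (edges start moves)
  open HitomezashiLoop public

  loopVertices : ∀ {x y} → HitomezashiLoop x y → List Vertex
  loopVertices L = vertices (start L) (moves L)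

  BoundingCylinder : ∀ {x y} → HitomezashiLoop x y → ℤ → ℤ → Set
  BoundingCylinder L m M =
    All (λ p → m ≤ proj₁ p × proj₁ p ≤ M) (loopVertices L)
    × Any (λ p → proj₁ p ≡ m) (loopVertices L)
    × Any (λ p → proj₁ p ≡ M) (loopVertices L)

-- Write X and Y for the prefix sums of x̃ and y, so that Σ_a^b(y) = Y (b+1) - Y a and
-- r(x) = max X - min X once X is periodic.  Give a vertical edge in column i ending in row t
-- the level 2 X t - Y i - Y (i+1), and a horizontal edge in row l ending in column c the level
-- X l + X (l+1) - 2 Y c.  Consecutive edges of an alternating directed walk have the same
-- level, so the loop, lifted to ℤ × ℤ, lies on a single level C.  A loop of homology class ±1
-- lifts to a walk from row l to row l ± N that meets the level of its first edge again N rows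
-- away; this makes X periodic.  The lift therefore crosses a row t⁺ where X is maximal and a
-- row t⁻ where X is minimal, by vertical edges oriented by y in columns i⁺ and i⁻; equal
-- levels give Y i⁺ - Y i⁻ = ± r(x), so the y-sum between the two columns is ±(r(x) + 1).
-- Every column in between is crossed by a horizontal edge of level C, and comparing two such
-- levels bounds every strictly shorter sum by r(x): the overflow is minimal.

module Submission where

open import Defs
open import Data.Nat.Base as ℕ using (ℕ; zero; suc; NonZero)
import Data.Nat.Properties as ℕₚ
open import Data.Nat.DivMod using (_mod_; m<n⇒m%n≡m)
open import Data.Integer.Base
  using (ℤ; +_; -[1+_]; _+_; _-_; -_; _*_; _≤_; _<_; ∣_∣; _%ℕ_; _/ℕ_; +≤+)
import Data.Integer.Properties as ℤₚ
open ℤₚ using (_≤?_; _<?_)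
open import Data.Integer.DivMod using (a≡a%ℕn+[a/ℕn]*n; n%ℕd<d)
open import Data.Integer.Tactic.RingSolver using (solve-∀)
open import Data.Fin.Base using (Fin; toℕ)
import Data.Fin.Properties as Finₚ
open import Data.List.Base using (List; []; _∷_; _++_; [_]; map; upTo)
open import Data.List.Relation.Unary.All as All using (All; []; _∷_)
open import Data.List.Relation.Unary.All.Properties using (all-upTo; map⁻)
open import Data.List.Relation.Unary.Any as Any using (Any; here; there)
open import Data.List.Relation.Unary.Linked using (Linked; [-]; _∷_)
open import Data.List.Membership.Propositional using (_∈_; lose)
open import Data.List.Membership.Propositional.Properties using (∈-upTo⁺)
open import Data.List.Extrema ℤₚ.≤-totalOrder
  using (argmax; argmin; argmax-all; argmin-all; f[xs]≤f[argmax]; f[argmin]≤f[xs])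
open import Data.Product using (_×_; _,_; proj₁; proj₂; ∃-syntax)
import Data.Product as Product
open import Data.Sum using (_⊎_; inj₁; inj₂)
import Data.Sum as Sum
open import Data.Empty using (⊥-elim)
open import Function using (_∘_)
open import Relation.Nullary using (¬_; yes; no)
open import Relation.Binary.Definitions using (tri<; tri≈; tri>)
open import Relation.Binary.PropositionalEquality
  using (_≡_; _≢_; refl; sym; trans; cong; cong₂; subst; subst₂; module ≡-Reasoning)

<⇒+1≤ : ∀ {i j} → i < j → i + + 1 ≤ j
<⇒+1≤ {i} i<j = subst (_≤ _) (ℤₚ.+-comm (+ 1) i) (ℤₚ.i<j⇒suc[i]≤j i<j)

+1≤⇒< : ∀ {i j} → i + + 1 ≤ j → i < j
+1≤⇒< {i} i+1≤j = ℤₚ.suc[i]≤j⇒i<j (subst (_≤ _) (ℤₚ.+-comm i (+ 1)) i+1≤j)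

i<i+1 : ∀ i → i < i + + 1
i<i+1 i = +1≤⇒< ℤₚ.≤-refl

i+[j-i]≡j : ∀ i j → i + (j - i) ≡ j
i+[j-i]≡j = solve-∀

i-j+j≡i : ∀ i j → i - j + j ≡ i
i-j+j≡i = solve-∀

i-1<i : ∀ i → i - + 1 < i
i-1<i i = +1≤⇒< (ℤₚ.≤-reflexive (i-j+j≡i i (+ 1)))

i+j-j≡i : ∀ i j → i + j - j ≡ i
i+j-j≡i = solve-∀

<⇒≤-1 : ∀ {i j} → i < j → i ≤ j - + 1
<⇒≤-1 {i} i<j = subst (_≤ _) (i+j-j≡i i (+ 1)) (ℤₚ.+-monoˡ-≤ (- + 1) (<⇒+1≤ i<j))

<+1⇒≤ : ∀ {i j} → i < j + + 1 → i ≤ j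
<+1⇒≤ {i} {j} i<j+1 = subst₂ _≤_ (i+j-j≡i i (+ 1)) (i+j-j≡i j (+ 1)) (ℤₚ.+-monoˡ-≤ (- + 1) (<⇒+1≤ i<j+1))

i≤i+n : ∀ i n → i ≤ i + + n
i≤i+n i n = subst (_≤ i + + n) (ℤₚ.+-identityʳ i) (ℤₚ.+-monoʳ-≤ i (+≤+ ℕ.z≤n))

-- The ring solver cannot use hypotheses; this lets it rearrange an equation a ≡ b.
≡-via-difference : ∀ {a b} p q → a ≡ b → a - b ≡ p - q → p ≡ q
≡-via-difference {a} {b} p q a≡b a-b≡p-q = ℤₚ.i-j≡0⇒i≡j p q (begin
  p - q ≡⟨ sym a-b≡p-q ⟩
  a - b ≡⟨ cong (_- b) a≡b ⟩
  b - b ≡⟨ ℤₚ.+-inverseʳ b ⟩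
  + 0   ∎)
  where open ≡-Reasoning

-- Prefix sums

-- prefix z i = Σ_0^{i-1}(z)
prefix : (ℤ → Sign) → ℤ → ℤ
prefix z (+ zero)     = + 0
prefix z (+ suc n)    = prefix z (+ n) + sgn (z (+ n))
prefix z -[1+ zero ]  = - sgn (z -[1+ zero ])
prefix z -[1+ suc n ] = prefix z -[1+ n ] - sgn (z -[1+ suc n ])

prefix-suc : ∀ z i → prefix z (i + + 1) ≡ prefix z i + sgn (z i)
prefix-suc z (+ n) rewrite ℕₚ.+-comm n 1 = refl
prefix-suc z -[1+ zero ]  = sym (ℤₚ.+-inverseˡ (sgn (z -[1+ zero ])))
prefix-suc z -[1+ suc n ] = sym (cancel (prefix z -[1+ n ]) (sgn (z -[1+ suc n ])))
  where cancel : ∀ a s → a - s + s ≡ a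
        cancel = solve-∀

prefix-step : ∀ z {i d} → z i ≡ d → prefix z (i + + 1) ≡ prefix z i + sgn d
prefix-step z {i} refl = prefix-suc z i

prefix-step-back : ∀ z {i d} → z (i - + 1) ≡ d → prefix z i ≡ prefix z (i - + 1) + sgn d
prefix-step-back z {i} z[i-1]≡d = trans (cong (prefix z) (sym (i-j+j≡i i (+ 1)))) (prefix-step z z[i-1]≡d)

sumFrom≡prefix-difference : ∀ z a n → sumFrom z a n ≡ prefix z (a + + n) - prefix z a
sumFrom≡prefix-difference z a zero rewrite ℤₚ.+-identityʳ a = sym (ℤₚ.+-inverseʳ (prefix z a))
sumFrom≡prefix-difference z a (suc n) = begin
  sgn (z a) + sumFrom z (a + + 1) n
    ≡⟨ cong (λ w → sgn (z a) + w) (sumFrom≡prefix-difference z (a + + 1) n) ⟩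
  sgn (z a) + (prefix z (a + + 1 + + n) - prefix z (a + + 1))
    ≡⟨ cong₂ (λ u v → sgn (z a) + (prefix z u - v)) (ℤₚ.+-assoc a (+ 1) (+ n)) (prefix-suc z a) ⟩
  sgn (z a) + (prefix z (a + + suc n) - (prefix z a + sgn (z a)))
    ≡⟨ regroup (sgn (z a)) (prefix z (a + + suc n)) (prefix z a) ⟩
  prefix z (a + + suc n) - prefix z a ∎
  where
  open ≡-Reasoning
  regroup : ∀ s u p → s + (u - (p + s)) ≡ u - p
  regroup = solve-∀

Σ≡prefix-difference : ∀ z a b → Σ[ z ] a to b ≡ prefix z (b + + 1) - prefix z a
Σ≡prefix-difference z a b with a ≤? b + + 1
... | yes a≤b+1 = begin
  sumFrom z a ∣ b + + 1 - a ∣       ≡⟨ sumFrom≡prefix-difference z a _ ⟩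
  prefix z (a + + ∣ b + + 1 - a ∣) - prefix z a
    ≡⟨ cong (λ u → prefix z (a + u) - prefix z a) (ℤₚ.0≤i⇒+∣i∣≡i (ℤₚ.i≤j⇒0≤j-i a≤b+1)) ⟩
  prefix z (a + (b + + 1 - a)) - prefix z a ≡⟨ cong (λ u → prefix z u - prefix z a) (i+[j-i]≡j a (b + + 1)) ⟩
  prefix z (b + + 1) - prefix z a   ∎
  where open ≡-Reasoning
... | no a≰b+1 = begin
  - sumFrom z (b + + 1) ∣ a - (b + + 1) ∣ ≡⟨ cong -_ (sumFrom≡prefix-difference z (b + + 1) _) ⟩
  - (prefix z (b + + 1 + + ∣ a - (b + + 1) ∣) - prefix z (b + + 1))
    ≡⟨ cong (λ u → - (prefix z (b + + 1 + u) - prefix z (b + + 1)))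
            (ℤₚ.0≤i⇒+∣i∣≡i (ℤₚ.i≤j⇒0≤j-i (ℤₚ.<⇒≤ (ℤₚ.≰⇒> a≰b+1)))) ⟩
  - (prefix z (b + + 1 + (a - (b + + 1))) - prefix z (b + + 1))
    ≡⟨ cong (λ u → - (prefix z u - prefix z (b + + 1))) (i+[j-i]≡j (b + + 1) a) ⟩
  - (prefix z a - prefix z (b + + 1)) ≡⟨ neg-difference (prefix z a) (prefix z (b + + 1)) ⟩
  prefix z (b + + 1) - prefix z a     ∎
  where
  open ≡-Reasoning
  neg-difference : ∀ u v → - (u - v) ≡ v - u
  neg-difference = solve-∀

prefix-min<max : ∀ z {t⁺ t⁻} → (∀ s → prefix z s ≤ prefix z t⁺) → (∀ s → prefix z t⁻ ≤ prefix z s) →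
                 prefix z t⁻ < prefix z t⁺
prefix-min<max z {t⁺} {t⁻} ≤max min≤ with z t⁺ in zt⁺
... | pos = ⊥-elim (ℤₚ.<⇒≱ (i<i+1 (prefix z t⁺)) (subst (_≤ prefix z t⁺) (prefix-step z zt⁺) (≤max (t⁺ + + 1))))
... | neg = ℤₚ.≤-<-trans (subst (prefix z t⁻ ≤_) (prefix-step z zt⁺) (min≤ (t⁺ + + 1)))
                         (i-1<i (prefix z t⁺))

-- Reduction modulo N

module _ {N : ℕ} .{{_ : NonZero N}} where

  remainder-unique : ∀ {r r' q} → r ℕ.< N → r' ℕ.< N → + r - + r' ≡ q * + N → r ≡ r'
  remainder-unique {r} {r'} {q} r<N r'<N r-r'≡qN =
    ℤₚ.+-injective (ℤₚ.i-j≡0⇒i≡j (+ r) (+ r') (ℤₚ.∣i∣≡0⇒i≡0 distance≡0))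
    where
    distance<N : ∣ + r - + r' ∣ ℕ.< N
    distance<N = subst (ℕ._< N) (cong ∣_∣ (sym (ℤₚ.m-n≡m⊖n r r')))
                   (ℕₚ.≤-<-trans (ℤₚ.∣m⊝n∣≤m⊔n r r') (ℕₚ.⊔-pres-<m r<N r'<N))
    distance≡0 : ∣ + r - + r' ∣ ≡ 0
    distance≡0 with ∣ q ∣ | trans (cong ∣_∣ r-r'≡qN) (ℤₚ.abs-* q (+ N))
    ... | zero  | distance≡0 = distance≡0
    ... | suc k | distance≡N+kN =
      ⊥-elim (ℕₚ.<⇒≱ distance<N (subst (N ℕ.≤_) (sym distance≡N+kN) (ℕₚ.m≤n*m N (suc k))))

  %ℕ-+-multiple : ∀ a q → (a + q * + N) %ℕ N ≡ a %ℕ N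
  %ℕ-+-multiple a q = remainder-unique {q = a /ℕ N + q - b /ℕ N} (n%ℕd<d b N) (n%ℕd<d a N)
    (≡-via-difference (+ (b %ℕ N) - + (a %ℕ N)) ((a /ℕ N + q - b /ℕ N) * + N)
      (trans (sym (a≡a%ℕn+[a/ℕn]*n b N)) (cong (_+ q * + N) (a≡a%ℕn+[a/ℕn]*n a N)))
      (rearrange (+ (b %ℕ N)) (b /ℕ N) (+ (a %ℕ N)) (a /ℕ N) q (+ N)))
    where
    b = a + q * + N
    rearrange : ∀ rb qb ra qa q n → rb + qb * n - (ra + qa * n + q * n) ≡ rb - ra - (qa + q - qb) * n
    rearrange = solve-∀

  toZN-+-multiple : ∀ a q → toZN N (a + q * + N) ≡ toZN N a
  toZN-+-multiple a q = cong (_mod N) (%ℕ-+-multiple a q)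

  toZN-+N : ∀ a → toZN N (a + + N) ≡ toZN N a
  toZN-+N a = trans (cong (λ n → toZN N (a + n)) (sym (ℤₚ.*-identityˡ (+ N)))) (toZN-+-multiple a (+ 1))

  toℕ-toZN : ∀ a → toℕ (toZN N a) ≡ a %ℕ N
  toℕ-toZN a = trans (Finₚ.toℕ-fromℕ< _) (m<n⇒m%n≡m (n%ℕd<d a N))

  toZN-toℕ : ∀ j → toZN N (+ toℕ j) ≡ j
  toZN-toℕ j = Finₚ.toℕ-injective (trans (toℕ-toZN (+ toℕ j)) (m<n⇒m%n≡m (Finₚ.toℕ<n j)))

  toZN-+ : ∀ a b → toZN N (+ toℕ (toZN N a) + b) ≡ toZN N (a + b)
  toZN-+ a b = begin
    toZN N (+ toℕ (toZN N a) + b)            ≡⟨ cong (λ r → toZN N (+ r + b)) (toℕ-toZN a) ⟩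
    toZN N (+ (a %ℕ N) + b)                  ≡⟨ sym (toZN-+-multiple (+ (a %ℕ N) + b) (a /ℕ N)) ⟩
    toZN N (+ (a %ℕ N) + b + a /ℕ N * + N)
      ≡⟨ cong (toZN N) (trans (swap (+ (a %ℕ N)) b (a /ℕ N * + N)) (cong (_+ b) (sym (a≡a%ℕn+[a/ℕn]*n a N)))) ⟩
    toZN N (a + b)                           ∎
    where
    open ≡-Reasoning
    swap : ∀ r b m → r + b + m ≡ r + m + b
    swap = solve-∀

-- Periodic functions on ℤ

step-invariant⇒constant : (f : ℤ → ℤ) → (∀ t → f (t + + 1) ≡ f t) → ∀ t → f t ≡ f (+ 0)
step-invariant⇒constant f inv (+ zero)      = refl
step-invariant⇒constant f inv (+ suc n)     =
  trans (cong (f ∘ +_) (ℕₚ.+-comm 1 n)) (trans (inv (+ n)) (step-invariant⇒constant f inv (+ n)))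
step-invariant⇒constant f inv -[1+ zero ]   = sym (inv -[1+ zero ])
step-invariant⇒constant f inv -[1+ suc n ]  =
  trans (sym (inv -[1+ suc n ])) (step-invariant⇒constant f inv -[1+ n ])

prefix-+-period : ∀ z N → (∀ t → z (t + + N) ≡ z t) → ∀ t → prefix z (t + + N) ≡ prefix z t + prefix z (+ N)
prefix-+-period z N periodic t = begin
  prefix z (t + + N)                         ≡⟨ sym (i+[j-i]≡j (prefix z t) (prefix z (t + + N))) ⟩
  prefix z t + (prefix z (t + + N) - prefix z t)
    ≡⟨ cong (λ w → prefix z t + w) (step-invariant⇒constant growth growth-step t) ⟩
  prefix z t + (prefix z (+ N) - + 0)
    ≡⟨ cong (λ w → prefix z t + w) (ℤₚ.+-identityʳ (prefix z (+ N))) ⟩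
  prefix z t + prefix z (+ N)                ∎
  where
  open ≡-Reasoning
  growth : ℤ → ℤ
  growth s = prefix z (s + + N) - prefix z s
  growth-step : ∀ s → growth (s + + 1) ≡ growth s
  growth-step s = begin
    prefix z (s + + 1 + + N) - prefix z (s + + 1)
      ≡⟨ cong₂ (λ u v → prefix z u - v) (commute s (+ N)) (prefix-suc z s) ⟩
    prefix z (s + + N + + 1) - (prefix z s + sgn (z s))
      ≡⟨ cong (_- (prefix z s + sgn (z s))) (prefix-suc z (s + + N)) ⟩
    prefix z (s + + N) + sgn (z (s + + N)) - (prefix z s + sgn (z s))
      ≡⟨ cong (λ d → prefix z (s + + N) + sgn d - (prefix z s + sgn (z s))) (periodic s) ⟩
    prefix z (s + + N) + sgn (z s) - (prefix z s + sgn (z s))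
      ≡⟨ cancel (prefix z (s + + N)) (prefix z s) (sgn (z s)) ⟩
    growth s ∎
    where
    commute : ∀ s n → s + + 1 + n ≡ s + n + + 1
    commute = solve-∀
    cancel : ∀ a b d → a + d - (b + d) ≡ a - b
    cancel = solve-∀

module Periodic {N : ℕ} .{{_ : NonZero N}} (f : ℤ → ℤ) (periodic : ∀ t → f (t + + N) ≡ f t) where

  periodic-ℕ-multiple : ∀ t n → f (t + + n * + N) ≡ f t
  periodic-ℕ-multiple t zero    = cong f (ℤₚ.+-identityʳ t)
  periodic-ℕ-multiple t (suc n) =
    trans (cong f (regroup t (+ n) (+ N))) (trans (periodic _) (periodic-ℕ-multiple t n))
    where regroup : ∀ t n m → t + (+ 1 + n) * m ≡ t + n * m + m
          regroup = solve-∀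

  periodic-multiple : ∀ t q → f (t + q * + N) ≡ f t
  periodic-multiple t (+ n)    = periodic-ℕ-multiple t n
  periodic-multiple t -[1+ n ] =
    trans (sym (periodic-ℕ-multiple (t + -[1+ n ] * + N) (suc n))) (cong f (cancel t (+ suc n) (+ N)))
    where cancel : ∀ t n m → t + - n * m + n * m ≡ t
          cancel = solve-∀

  window : ∀ b t → ∃[ k ] (k ℕ.< N × f t ≡ f (b + + k))
  window b t = (t - b) %ℕ N , n%ℕd<d (t - b) N ,
    trans (cong f (regroup (a≡a%ℕn+[a/ℕn]*n (t - b) N))) (periodic-multiple _ ((t - b) /ℕ N))
    where
    regroup : ∀ {t b r q} → t - b ≡ r + q → t ≡ b + r + q
    regroup {t} {b} {r} {q} t-b≡ =
      trans (sym (i+[j-i]≡j b t)) (trans (cong (λ w → b + w) t-b≡) (sym (ℤₚ.+-assoc b r q)))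

  maximum-in-window : ∀ b → ∃[ k ] (k ℕ.< N × ∀ t → f t ≤ f (b + + k))
  maximum-in-window b = k , argmax-all value (ℕ.>-nonZero⁻¹ N) (all-upTo N) , below
    where
    value : ℕ → ℤ
    value j = f (b + + j)
    k = argmax value 0 (upTo N)
    below : ∀ t → f t ≤ value k
    below t with window b t
    ... | j , j<N , ft≡ = subst (_≤ value k) (sym ft≡) (All.lookup (f[xs]≤f[argmax] 0 (upTo N)) (∈-upTo⁺ j<N))

  minimum-in-window : ∀ b → ∃[ k ] (k ℕ.< N × ∀ t → f (b + + k) ≤ f t)
  minimum-in-window b = k , argmin-all value (ℕ.>-nonZero⁻¹ N) (all-upTo N) , above
    where
    value : ℕ → ℤ
    value j = f (b + + j)
    k = argmin value 0 (upTo N)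
    above : ∀ t → value k ≤ f t
    above t with window b t
    ... | j , j<N , ft≡ = subst (value k ≤_) (sym ft≡) (All.lookup (f[argmin]≤f[xs] 0 (upTo N)) (∈-upTo⁺ j<N))

-- Levels of edges

Between : ℤ → ℤ → ℤ → Set
Between a b c = (a ≤ c × c < b) ⊎ (b ≤ c × c < a)

module Levels (X Y : ℤ → ℤ) where

  -- the vertical edge in column i between rows t - 1 and t
  verticalLevel : ℤ → ℤ → ℤ
  verticalLevel i t = + 2 * X t - (Y i + Y (i + + 1))

  -- the horizontal edge in row l between columns c - 1 and c
  horizontalLevel : ℤ → ℤ → ℤ
  horizontalLevel c l = X l + X (l + + 1) - + 2 * Y c

  upward-level : ∀ {i t} → Y (i + + 1) ≡ Y i + + 1 → verticalLevel i t ≡ + 2 * (X t - Y i) - + 1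
  upward-level {i} {t} up = trans (cong (λ u → + 2 * X t - (Y i + u)) up) (regroup (X t) (Y i))
    where regroup : ∀ x y → + 2 * x - (y + (y + + 1)) ≡ + 2 * (x - y) - + 1
          regroup = solve-∀

  vertical-gap : ∀ {C i j s t} → Y (i + + 1) ≡ Y i + + 1 → Y (j + + 1) ≡ Y j + + 1 →
                 verticalLevel i s ≡ C → verticalLevel j t ≡ C → Y i - Y j ≡ X s - X t
  vertical-gap {i = i} {j} {s} {t} up-i up-j level-i level-j = ℤₚ.*-cancelˡ-≡ (+ 2) _ _
    (≡-via-difference (+ 2 * (Y i - Y j)) (+ 2 * (X s - X t))
      (trans (sym (upward-level up-j)) (trans level-j (trans (sym level-i) (upward-level up-i))))
      (rearrange (X t) (Y j) (X s) (Y i)))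
    where rearrange : ∀ xt yj xs yi → + 2 * (xt - yj) - + 1 - (+ 2 * (xs - yi) - + 1) ≡
                                      + 2 * (yi - yj) - + 2 * (xs - xt)
          rearrange = solve-∀

  module _ (t⁺ t⁻ : ℤ) (≤max : ∀ s → X s ≤ X t⁺) (min≤ : ∀ s → X t⁻ ≤ X s) where

    horizontal-gap : ∀ {C a b k l} → horizontalLevel a k ≡ C → horizontalLevel b l ≡ C →
                     Y b - Y a ≤ X t⁺ - X t⁻
    horizontal-gap {a = a} {b} {k} {l} level-a level-b = ℤₚ.*-cancelˡ-≤-pos _ _ (+ 2) (begin
      + 2 * (Y b - Y a)
        ≡⟨ ≡-via-difference _ _ (trans level-a (sym level-b))
                                (rearrange (X k) (X (k + + 1)) (Y a) (X l) (X (l + + 1)) (Y b)) ⟩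
      X l + X (l + + 1) - (X k + X (k + + 1))
        ≤⟨ ℤₚ.+-mono-≤ (ℤₚ.+-mono-≤ (≤max l) (≤max (l + + 1)))
                       (ℤₚ.neg-mono-≤ (ℤₚ.+-mono-≤ (min≤ k) (min≤ (k + + 1)))) ⟩
      X t⁺ + X t⁺ - (X t⁻ + X t⁻)
        ≡⟨ double (X t⁺) (X t⁻) ⟩
      + 2 * (X t⁺ - X t⁻) ∎)
      where
      open ℤₚ.≤-Reasoning
      rearrange : ∀ xk xk' ya xl xl' yb → xk + xk' - + 2 * ya - (xl + xl' - + 2 * yb) ≡
                                           + 2 * (yb - ya) - (xl + xl' - (xk + xk'))
      rearrange = solve-∀
      double : ∀ p q → p + p - (q + q) ≡ + 2 * (p - q)
      double = solve-∀

    -- Such a horizontal edge would force X l + X (l + 1) = 2 X t⁺ + 1.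
    beside-maximum : ∀ {C i l} → Y (i + + 1) ≡ Y i + + 1 → verticalLevel i t⁺ ≡ C →
                     horizontalLevel (i + + 1) l ≢ C
    beside-maximum {i = i} {l} up level-i level-l = ℤₚ.<⇒≱ (i<i+1 (X t⁺ + X t⁺)) (begin
      X t⁺ + X t⁺ + + 1 ≡⟨ sym (≡-via-difference _ _ same-level (rearrange (X l) (X (l + + 1)) (Y i) (X t⁺))) ⟩
      X l + X (l + + 1) ≤⟨ ℤₚ.+-mono-≤ (≤max l) (≤max (l + + 1)) ⟩
      X t⁺ + X t⁺       ∎)
      where
      open ℤₚ.≤-Reasoning
      same-level : X l + X (l + + 1) - + 2 * (Y i + + 1) ≡ + 2 * (X t⁺ - Y i) - + 1
      same-level = trans (cong (λ u → X l + X (l + + 1) - + 2 * u) (sym up))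
                         (trans level-l (trans (sym level-i) (upward-level up)))
      rearrange : ∀ xl xl' yi xt → xl + xl' - + 2 * (yi + + 1) - (+ 2 * (xt - yi) - + 1) ≡
                                   xl + xl' - (xt + xt + + 1)
      rearrange = solve-∀

    interlacing : ∀ {C i⁺ i⁻} → X t⁻ < X t⁺ →
      Y (i⁺ + + 1) ≡ Y i⁺ + + 1 → Y (i⁻ + + 1) ≡ Y i⁻ + + 1 →
      verticalLevel i⁺ t⁺ ≡ C → verticalLevel i⁻ t⁻ ≡ C →
      (∀ c → Between i⁻ i⁺ c → ∃[ l ] horizontalLevel (c + + 1) l ≡ C) →
      i⁻ < i⁺ × Y i⁺ - Y i⁻ ≡ X t⁺ - X t⁻ ×
      (∀ c d → i⁻ < c → c ≤ d → d < i⁺ → Y (d + + 1) - Y c ≤ X t⁺ - X t⁻)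
    interlacing {C} {i⁺} {i⁻} min<max up⁺ up⁻ level⁺ level⁻ crossed = ordered , gap , inner
      where
      gap : Y i⁺ - Y i⁻ ≡ X t⁺ - X t⁻
      gap = vertical-gap up⁺ up⁻ level⁺ level⁻
      ordered : i⁻ < i⁺
      ordered with ℤₚ.<-cmp i⁻ i⁺
      ... | tri< i⁻<i⁺ _ _ = i⁻<i⁺
      ... | tri≈ _ refl _  = ⊥-elim (ℤₚ.<⇒≢ min<max
            (sym (ℤₚ.i-j≡0⇒i≡j _ _ (trans (sym gap) (ℤₚ.+-inverseʳ (Y i⁺))))))
      ... | tri> _ _ i⁺<i⁻ with crossed i⁺ (inj₂ (ℤₚ.≤-refl , i⁺<i⁻))
      ...   | _ , level = ⊥-elim (beside-maximum up⁺ level⁺ level)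
      inner : ∀ c d → i⁻ < c → c ≤ d → d < i⁺ → Y (d + + 1) - Y c ≤ X t⁺ - X t⁻
      inner c d i⁻<c c≤d d<i⁺
        with crossed (c - + 1) (inj₁ (<⇒≤-1 i⁻<c , ℤₚ.<-≤-trans (i-1<i c) (ℤₚ.≤-trans c≤d (ℤₚ.<⇒≤ d<i⁺))))
           | crossed d (inj₁ (ℤₚ.≤-trans (ℤₚ.<⇒≤ i⁻<c) c≤d , d<i⁺))
      ... | _ , level-c | _ , level-d =
        horizontal-gap (subst (λ u → horizontalLevel u _ ≡ C) (i-j+j≡i c (+ 1)) level-c) level-d

-- Walks in the plane ℤ × ℤ

Point : Set
Point = ℤ × ℤ

column row : Point → ℤ
column = proj₁
row    = proj₂

step : Point → Move → Point
step (i , l) (mv hor d) = i + sgn d , l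
step (i , l) (mv ver d) = i , l + sgn d

steps : Point → List Move → List (Point × Move)
steps p []       = []
steps p (m ∷ ms) = (p , m) ∷ steps (step p m) ms

final : Point → List Move → Point
final p []       = p
final p (m ∷ ms) = final (step p m) ms

crosses-row-upwards : ∀ p ms t → row p < t → t ≤ row (final p ms) →
                      ∃[ q ] (row q + + 1 ≡ t × (q , mv ver pos) ∈ steps p ms)
crosses-row-upwards p [] t p<t t≤p = ⊥-elim (ℤₚ.<⇒≱ p<t t≤p)
crosses-row-upwards (i , l) (mv hor d ∷ ms) t l<t t≤ =
  Product.map₂ (Product.map₂ there) (crosses-row-upwards (i + sgn d , l) ms t l<t t≤)
crosses-row-upwards (i , l) (mv ver neg ∷ ms) t l<t t≤ =
  Product.map₂ (Product.map₂ there) (crosses-row-upwards (i , l - + 1) ms t (ℤₚ.<-trans (i-1<i l) l<t) t≤)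
crosses-row-upwards (i , l) (mv ver pos ∷ ms) t l<t t≤ with l + + 1 <? t
... | yes l+1<t = Product.map₂ (Product.map₂ there) (crosses-row-upwards (i , l + + 1) ms t l+1<t t≤)
... | no  l+1≮t = (i , l) , ℤₚ.≤-antisym (<⇒+1≤ l<t) (ℤₚ.≮⇒≥ l+1≮t) , here refl

crosses-row-downwards : ∀ p ms t → row (final p ms) < t → t ≤ row p →
                        ∃[ q ] (row q ≡ t × (q , mv ver neg) ∈ steps p ms)
crosses-row-downwards p [] t p<t t≤p = ⊥-elim (ℤₚ.<⇒≱ p<t t≤p)
crosses-row-downwards (i , l) (mv hor d ∷ ms) t <t t≤l =
  Product.map₂ (Product.map₂ there) (crosses-row-downwards (i + sgn d , l) ms t <t t≤l)
crosses-row-downwards (i , l) (mv ver pos ∷ ms) t <t t≤l =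
  Product.map₂ (Product.map₂ there)
    (crosses-row-downwards (i , l + + 1) ms t <t (ℤₚ.≤-trans t≤l (ℤₚ.<⇒≤ (i<i+1 l))))
crosses-row-downwards (i , l) (mv ver neg ∷ ms) t <t t≤l with t ≤? l - + 1
... | yes t≤l-1 = Product.map₂ (Product.map₂ there) (crosses-row-downwards (i , l - + 1) ms t <t t≤l-1)
... | no  t≰l-1 = (i , l) , ℤₚ.≤-antisym (subst (_≤ t) (i-j+j≡i l (+ 1)) (<⇒+1≤ (ℤₚ.≰⇒> t≰l-1))) t≤l , here refl

HorizontalCrossing : List (Point × Move) → ℤ → Set
HorizontalCrossing xs c = ∃[ l ] (((c , l) , mv hor pos) ∈ xs ⊎ ((c + + 1 , l) , mv hor neg) ∈ xs)

crosses-column : ∀ p ms c → Any (λ s → column (proj₁ s) ≤ c) (steps p ms) →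
                 Any (λ s → c < column (proj₁ s)) (steps p ms) → HorizontalCrossing (steps p ms) c
crosses-column p ms c left right with column p ≤? c
... | yes p≤c = rightwards p ms p≤c right
  where
  rightwards : ∀ p ms → column p ≤ c → Any (λ s → c < column (proj₁ s)) (steps p ms) →
               HorizontalCrossing (steps p ms) c
  rightwards p (m ∷ ms) p≤c (here c<p) = ⊥-elim (ℤₚ.<⇒≱ c<p p≤c)
  rightwards (i , l) (mv ver d ∷ ms) i≤c (there a) =
    Product.map₂ (Sum.map there there) (rightwards (i , l + sgn d) ms i≤c a)
  rightwards (i , l) (mv hor neg ∷ ms) i≤c (there a) =
    Product.map₂ (Sum.map there there) (rightwards (i - + 1 , l) ms (ℤₚ.≤-trans (ℤₚ.<⇒≤ (i-1<i i)) i≤c) a)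
  rightwards (i , l) (mv hor pos ∷ ms) i≤c (there a) with i + + 1 ≤? c
  ... | yes i+1≤c = Product.map₂ (Sum.map there there) (rightwards (i + + 1 , l) ms i+1≤c a)
  ... | no  i+1≰c with ℤₚ.≤-antisym i≤c (<+1⇒≤ (ℤₚ.≰⇒> i+1≰c))
  ...   | refl = l , inj₁ (here refl)
... | no p≰c = leftwards p ms (ℤₚ.≰⇒> p≰c) left
  where
  leftwards : ∀ p ms → c < column p → Any (λ s → column (proj₁ s) ≤ c) (steps p ms) →
              HorizontalCrossing (steps p ms) c
  leftwards p (m ∷ ms) c<p (here p≤c) = ⊥-elim (ℤₚ.<⇒≱ c<p p≤c)
  leftwards (i , l) (mv ver d ∷ ms) c<i (there a) =
    Product.map₂ (Sum.map there there) (leftwards (i , l + sgn d) ms c<i a)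
  leftwards (i , l) (mv hor pos ∷ ms) c<i (there a) =
    Product.map₂ (Sum.map there there) (leftwards (i + + 1 , l) ms (ℤₚ.<-trans c<i (i<i+1 i)) a)
  leftwards (i , l) (mv hor neg ∷ ms) c<i (there a) with c <? i - + 1
  ... | yes c<i-1 = Product.map₂ (Sum.map there there) (leftwards (i - + 1 , l) ms c<i-1 a)
  ... | no  c≮i-1 with ℤₚ.≤-antisym (subst (_≤ c + + 1) (i-j+j≡i i (+ 1)) (ℤₚ.+-monoˡ-≤ (+ 1) (ℤₚ.≮⇒≥ c≮i-1)))
                                    (<⇒+1≤ c<i)
  ...   | refl = l , inj₂ (here refl)

-- The oriented cloth on ℤ × ℤ

module PlaneCloth (x̃ y : ℤ → Sign) where

  open Levels (prefix x̃) (prefix y) public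

  Legal : Point × Move → Set
  Legal ((i , l) , mv hor d) = x̃ l ≡ d
  Legal ((i , l) , mv ver d) = y i ≡ d

  -- A step's level depends only on the edge it traverses.
  level : Point × Move → ℤ
  level ((i , l) , mv hor pos) = horizontalLevel (i + + 1) l
  level ((i , l) , mv hor neg) = horizontalLevel i l
  level ((i , l) , mv ver pos) = verticalLevel i (l + + 1)
  level ((i , l) , mv ver neg) = verticalLevel i l

  private
    X Y : ℤ → ℤ
    X = prefix x̃
    Y = prefix y

  level-preserved : ∀ {p m m'} → kind m ≢ kind m' → Legal (p , m) → Legal (step p m , m') →
                    level (p , m) ≡ level (step p m , m')
  level-preserved {m = mv hor _} {mv hor _} turn _ _ = ⊥-elim (turn refl)
  level-preserved {m = mv ver _} {mv ver _} turn _ _ = ⊥-elim (turn refl)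
  level-preserved {i , l} {mv hor pos} {mv ver pos} _ a b
    rewrite prefix-step x̃ a | prefix-step y b = rearrange (X l) (Y (i + + 1))
    where rearrange : ∀ x y → x + (x + + 1) - + 2 * y ≡ + 2 * (x + + 1) - (y + (y + + 1))
          rearrange = solve-∀
  level-preserved {i , l} {mv hor pos} {mv ver neg} _ a b
    rewrite prefix-step x̃ a | prefix-step y b = rearrange (X l) (Y (i + + 1))
    where rearrange : ∀ x y → x + (x + + 1) - + 2 * y ≡ + 2 * x - (y + (y - + 1))
          rearrange = solve-∀
  level-preserved {i , l} {mv hor neg} {mv ver pos} _ a b
    rewrite prefix-step x̃ a | prefix-step-back y {i} b | prefix-step y b = rearrange (X l) (Y (i - + 1))
    where rearrange : ∀ x y → x + (x - + 1) - + 2 * (y + + 1) ≡ + 2 * (x - + 1) - (y + (y + + 1))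
          rearrange = solve-∀
  level-preserved {i , l} {mv hor neg} {mv ver neg} _ a b
    rewrite prefix-step x̃ a | prefix-step-back y {i} b | prefix-step y b = rearrange (X l) (Y (i - + 1))
    where rearrange : ∀ x y → x + (x - + 1) - + 2 * (y - + 1) ≡ + 2 * x - (y + (y - + 1))
          rearrange = solve-∀
  level-preserved {i , l} {mv ver pos} {mv hor pos} _ a b
    rewrite prefix-step y a | prefix-step x̃ b = rearrange (X (l + + 1)) (Y i)
    where rearrange : ∀ x y → + 2 * x - (y + (y + + 1)) ≡ x + (x + + 1) - + 2 * (y + + 1)
          rearrange = solve-∀
  level-preserved {i , l} {mv ver pos} {mv hor neg} _ a b
    rewrite prefix-step y a | prefix-step x̃ b = rearrange (X (l + + 1)) (Y i)
    where rearrange : ∀ x y → + 2 * x - (y + (y + + 1)) ≡ x + (x - + 1) - + 2 * y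
          rearrange = solve-∀
  level-preserved {i , l} {mv ver neg} {mv hor pos} _ a b
    rewrite prefix-step y a | prefix-step-back x̃ {l} b | prefix-step x̃ b = rearrange (X (l - + 1)) (Y i)
    where rearrange : ∀ x y → + 2 * (x + + 1) - (y + (y - + 1)) ≡ x + (x + + 1) - + 2 * (y - + 1)
          rearrange = solve-∀
  level-preserved {i , l} {mv ver neg} {mv hor neg} _ a b
    rewrite prefix-step y a | prefix-step-back x̃ {l} b | prefix-step x̃ b = rearrange (X (l - + 1)) (Y i)
    where rearrange : ∀ x y → + 2 * (x - + 1) - (y + (y - + 1)) ≡ x + (x - + 1) - + 2 * y
          rearrange = solve-∀

  level-along : ∀ p m ms m₀ → All Legal (steps p (m ∷ ms)) →
                Linked (λ a b → kind a ≢ kind b) ((m ∷ ms) ++ [ m₀ ]) →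
                All (λ s → level s ≡ level (p , m)) (steps p (m ∷ ms))
  level-along p m []        m₀ _                 _              = refl ∷ []
  level-along p m (m' ∷ ms) m₀ (legal ∷ legals) (turn ∷ turns) =
    refl ∷ All.map (λ e → trans e (sym (level-preserved turn legal (All.head legals))))
                   (level-along (step p m) m' ms m₀ legals turns)

  level-closing : ∀ p m ms m₀ → All Legal (steps p (m ∷ ms)) →
                  Linked (λ a b → kind a ≢ kind b) ((m ∷ ms) ++ [ m₀ ]) →
                  Legal (final p (m ∷ ms) , m₀) → level (final p (m ∷ ms) , m₀) ≡ level (p , m)
  level-closing p m []        m₀ (legal ∷ [])      (turn ∷ [-])   legal₀ = sym (level-preserved turn legal legal₀)
  level-closing p m (m' ∷ ms) m₀ (legal ∷ legals) (turn ∷ turns) legal₀ =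
    trans (level-closing (step p m) m' ms m₀ legals turns legal₀)
          (sym (level-preserved turn legal (All.head legals)))

  private
    shift-next : ∀ {n D} → (∀ t → X (t + n) ≡ X t + D) → ∀ l → X (l + n + + 1) ≡ X (l + + 1) + D
    shift-next {n} shift l = trans (cong X (commute l n)) (shift (l + + 1))
      where commute : ∀ l n → l + n + + 1 ≡ l + + 1 + n
            commute = solve-∀
    regroup-horizontal : ∀ a b c d → a + d + (b + d) - + 2 * c ≡ a + b - + 2 * c + + 2 * d
    regroup-horizontal = solve-∀
    regroup-vertical : ∀ a c d → + 2 * (a + d) - c ≡ + 2 * a - c + + 2 * d
    regroup-vertical = solve-∀

  level-+-rows : ∀ {n D} → (∀ t → X (t + n) ≡ X t + D) →
                 ∀ i l m → level ((i , l + n) , m) ≡ level ((i , l) , m) + + 2 * D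
  level-+-rows {D = D} shift i l (mv hor pos) rewrite shift l | shift-next shift l =
    regroup-horizontal (X l) (X (l + + 1)) (Y (i + + 1)) D
  level-+-rows {D = D} shift i l (mv hor neg) rewrite shift l | shift-next shift l =
    regroup-horizontal (X l) (X (l + + 1)) (Y i) D
  level-+-rows {D = D} shift i l (mv ver pos) rewrite shift-next shift l =
    regroup-vertical (X (l + + 1)) (Y i + Y (i + + 1)) D
  level-+-rows {D = D} shift i l (mv ver neg) rewrite shift l =
    regroup-vertical (X l) (Y i + Y (i + + 1)) D

-- Lifting the cloth on ℤ × ℤ/Nℤ to the plane

module Lift (N : ℕ) .{{_ : NonZero N}} (x : Fin N → Sign) (y : ℤ → Sign) where

  open PlaneCloth (xper N x) y public

  X Y : ℤ → ℤ
  X = prefix (xper N x)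
  Y = prefix y

  project : Point → Vertex N
  project (i , l) = i , toZN N l

  shift-project : ∀ p m → shift N (project p) m ≡ project (step p m)
  shift-project (i , l) (mv hor d) = refl
  shift-project (i , l) (mv ver d) = cong (λ j → i , j) (toZN-+ l (sgn d))

  legal-project : ∀ p m → Allowed N x y (project p) m → Legal (p , m)
  legal-project p (mv hor d) allowed = allowed
  legal-project p (mv ver d) allowed = allowed

  legal-lift : ∀ p ms → ValidWalk N x y (project p) ms → All Legal (steps p ms)
  legal-lift p []       _                = []
  legal-lift p (m ∷ ms) (allowed , valid) =
    legal-project p m allowed ∷
    legal-lift (step p m) ms (subst (λ v → ValidWalk N x y v ms) (shift-project p m) valid)

  vertices-project : ∀ p ms → vertices N (project p) ms ≡ map (project ∘ proj₁) (steps p ms)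
  vertices-project p []       = refl
  vertices-project p (m ∷ ms) =
    cong (project p ∷_) (trans (cong (λ v → vertices N v ms) (shift-project p m)) (vertices-project (step p m) ms))

  endpoint-project : ∀ p ms → endpoint N (project p) ms ≡ project (final p ms)
  endpoint-project p []       = refl
  endpoint-project p (m ∷ ms) =
    trans (cong (λ v → endpoint N v ms) (shift-project p m)) (endpoint-project (step p m) ms)

  row-final : ∀ p ms → row (final p ms) ≡ row p + Δy N ms
  row-final p [] = sym (ℤₚ.+-identityʳ (row p))
  row-final (i , l) (mv hor d ∷ ms) =
    trans (row-final (i + sgn d , l) ms) (cong (λ δ → l + δ) (sym (ℤₚ.+-identityˡ (Δy N ms))))
  row-final (i , l) (mv ver d ∷ ms) = trans (row-final (i , l + sgn d) ms) (ℤₚ.+-assoc l (sgn d) (Δy N ms))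

  -- Meeting the level of an edge again one period higher forces Σ(x) = X N to vanish.
  periodic-if-level-repeats : ∀ i l m → level ((i , l + + N) , m) ≡ level ((i , l) , m) →
                              ∀ t → X (t + + N) ≡ X t
  periodic-if-level-repeats i l m repeats t = begin
    X (t + + N)       ≡⟨ X-+-period t ⟩
    X t + X (+ N)     ≡⟨ cong (λ D → X t + D) X[N]≡0 ⟩
    X t + + 0         ≡⟨ ℤₚ.+-identityʳ (X t) ⟩
    X t               ∎
    where
    open ≡-Reasoning
    X-+-period : ∀ t → X (t + + N) ≡ X t + X (+ N)
    X-+-period = prefix-+-period (xper N x) N (λ t → cong x (toZN-+N t))
    cancel : ∀ a d → a + + 2 * d - a ≡ + 2 * d - + 0
    cancel = solve-∀
    X[N]≡0 : X (+ N) ≡ + 0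
    X[N]≡0 = ℤₚ.*-cancelˡ-≡ (+ 2) (X (+ N)) (+ 0)
      (≡-via-difference _ _ (trans (sym (level-+-rows X-+-period i l m)) repeats)
                        (cancel (level ((i , l) , m)) (X (+ N))))

  module Mirror = Levels (λ t → - X t) (λ i → - Y i)

  mirror-vertical : ∀ {C} i t → verticalLevel i t ≡ C → Mirror.verticalLevel i t ≡ - C
  mirror-vertical i t level = trans (negate (X t) (Y i) (Y (i + + 1))) (cong -_ level)
    where negate : ∀ a b c → + 2 * - a - (- b + - c) ≡ - (+ 2 * a - (b + c))
          negate = solve-∀

  mirror-horizontal : ∀ {C} c l → horizontalLevel c l ≡ C → Mirror.horizontalLevel c l ≡ - C
  mirror-horizontal c l level = trans (negate (X l) (X (l + + 1)) (Y c)) (cong -_ level)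
    where negate : ∀ a b c → - a + - b - + 2 * - c ≡ - (a + b - + 2 * c)
          negate = solve-∀

  mirror-up : ∀ {i} → y i ≡ neg → - Y (i + + 1) ≡ - Y i + + 1
  mirror-up {i} yi = trans (cong -_ (prefix-step y yi)) (negate (Y i))
    where negate : ∀ a → - (a - + 1) ≡ - a + + 1
          negate = solve-∀

  module _ (t⁺ t⁻ : ℤ) (≤max : ∀ s → X s ≤ X t⁺) (min≤ : ∀ s → X t⁻ ≤ X s) where

    Σx≤oscillation : ∀ a b → Σ[ xper N x ] a to b ≤ X t⁺ - X t⁻
    Σx≤oscillation a b = subst (_≤ X t⁺ - X t⁻) (sym (Σ≡prefix-difference (xper N x) a b))
                               (ℤₚ.+-mono-≤ (≤max (b + + 1)) (ℤₚ.neg-mono-≤ (min≤ a)))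

    r≤oscillation : ∀ {r} → IsR N x r → r ≤ X t⁺ - X t⁻
    r≤oscillation (_ , a , b , _ , Σ≡r) = subst (_≤ X t⁺ - X t⁻) Σ≡r (Σx≤oscillation a b)

    oscillation-isR : (∀ t → X (t + + N) ≡ X t) → IsR N x (X t⁺ - X t⁻)
    oscillation-isR periodic with Periodic.window X periodic t⁻ t⁺
    ... | k , _ , X[t⁺]≡ = (λ a b _ → Σx≤oscillation a b) , t⁻ , t⁻ + + k - + 1 ,
      subst (t⁻ ≤_) (sym (i-j+j≡i (t⁻ + + k) (+ 1))) (i≤i+n t⁻ k) ,
      trans (Σ≡prefix-difference (xper N x) t⁻ _)
            (cong (λ u → u - X t⁻) (trans (cong X (i-j+j≡i (t⁻ + + k) (+ 1))) (sym X[t⁺]≡)))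

    minimal-positive-overflow :
      ∀ {C i⁺ i⁻} → (∀ t → X (t + + N) ≡ X t) → y i⁺ ≡ pos → y i⁻ ≡ pos →
      verticalLevel i⁺ t⁺ ≡ C → verticalLevel i⁻ t⁻ ≡ C →
      (∀ c → Between i⁻ i⁺ c → ∃[ l ] horizontalLevel (c + + 1) l ≡ C) →
      i⁻ < i⁺ × MinPosOverflowing N x y i⁻ i⁺
    minimal-positive-overflow {_} {i⁺} {i⁻} periodic y⁺ y⁻ level⁺ level⁻ crossed =
      i⁻<i⁺ , overflowing , minimal
      where
      R : ℤ
      R = X t⁺ - X t⁻
      interlaced : i⁻ < i⁺ × Y i⁺ - Y i⁻ ≡ R × (∀ c d → i⁻ < c → c ≤ d → d < i⁺ → Y (d + + 1) - Y c ≤ R)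
      interlaced = interlacing t⁺ t⁻ ≤max min≤ (prefix-min<max (xper N x) {t⁺} {t⁻} ≤max min≤)
                     (prefix-step y y⁺) (prefix-step y y⁻) level⁺ level⁻ crossed
      i⁻<i⁺ : i⁻ < i⁺
      i⁻<i⁺ = proj₁ interlaced
      gap : Y i⁺ - Y i⁻ ≡ R
      gap = proj₁ (proj₂ interlaced)
      inner : ∀ c d → i⁻ < c → c ≤ d → d < i⁺ → Y (d + + 1) - Y c ≤ R
      inner = proj₂ (proj₂ interlaced)
      whole : Σ[ y ] i⁻ to i⁺ ≡ R + + 1
      whole = begin
        Σ[ y ] i⁻ to i⁺           ≡⟨ Σ≡prefix-difference y i⁻ i⁺ ⟩
        Y (i⁺ + + 1) - Y i⁻       ≡⟨ cong (_- Y i⁻) (prefix-step y y⁺) ⟩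
        Y i⁺ + + 1 - Y i⁻         ≡⟨ commute (Y i⁺) (Y i⁻) ⟩
        Y i⁺ - Y i⁻ + + 1         ≡⟨ cong (_+ + 1) gap ⟩
        R + + 1                   ∎
        where
        open ≡-Reasoning
        commute : ∀ a b → a + + 1 - b ≡ a - b + + 1
        commute = solve-∀
      overflowing : PosOverflowing N x y i⁻ i⁺
      overflowing r isR = subst (r <_) (sym whole) (ℤₚ.≤-<-trans (r≤oscillation isR) (i<i+1 R))
      minimal : ∀ c d → i⁻ < c → c ≤ d → d < i⁺ → ¬ PosOverflowing N x y c d
      minimal c d i⁻<c c≤d d<i⁺ overflow =
        ℤₚ.<⇒≱ (subst (R <_) (Σ≡prefix-difference y c d) (overflow R (oscillation-isR periodic)))
               (inner c d i⁻<c c≤d d<i⁺)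

    -- Negating X, Y and all levels turns downward edges into upward ones and swaps the
    -- roles of maximum and minimum, so the positive argument applies.
    minimal-negative-overflow :
      ∀ {C i⁺ i⁻} → (∀ t → X (t + + N) ≡ X t) → y i⁺ ≡ neg → y i⁻ ≡ neg →
      verticalLevel i⁺ t⁺ ≡ C → verticalLevel i⁻ t⁻ ≡ C →
      (∀ c → Between i⁺ i⁻ c → ∃[ l ] horizontalLevel (c + + 1) l ≡ C) →
      i⁺ < i⁻ × MinNegOverflowing N x y i⁺ i⁻
    minimal-negative-overflow {_} {i⁺} {i⁻} periodic y⁺ y⁻ level⁺ level⁻ crossed =
      i⁺<i⁻ , overflowing , minimal
      where
      R : ℤ
      R = X t⁺ - X t⁻
      mirror-R : ∀ a b → - b - - a ≡ a - b
      mirror-R = solve-∀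
      interlaced : i⁺ < i⁻ × - Y i⁻ - - Y i⁺ ≡ - X t⁻ - - X t⁺ ×
                   (∀ c d → i⁺ < c → c ≤ d → d < i⁻ → - Y (d + + 1) - - Y c ≤ - X t⁻ - - X t⁺)
      interlaced = Mirror.interlacing t⁻ t⁺ (λ s → ℤₚ.neg-mono-≤ (min≤ s)) (λ s → ℤₚ.neg-mono-≤ (≤max s))
                     (ℤₚ.neg-mono-< (prefix-min<max (xper N x) {t⁺} {t⁻} ≤max min≤)) (mirror-up y⁻) (mirror-up y⁺)
                     (mirror-vertical i⁻ t⁻ level⁻) (mirror-vertical i⁺ t⁺ level⁺)
                     (λ c between → Product.map₂ (λ {l} → mirror-horizontal (c + + 1) l) (crossed c between))
      i⁺<i⁻ : i⁺ < i⁻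
      i⁺<i⁻ = proj₁ interlaced
      gap : - Y i⁻ - - Y i⁺ ≡ - X t⁻ - - X t⁺
      gap = proj₁ (proj₂ interlaced)
      inner : ∀ c d → i⁺ < c → c ≤ d → d < i⁻ → - Y (d + + 1) - - Y c ≤ - X t⁻ - - X t⁺
      inner = proj₂ (proj₂ interlaced)
      whole : Σ[ y ] i⁺ to i⁻ ≡ - R - + 1
      whole = begin
        Σ[ y ] i⁺ to i⁻           ≡⟨ Σ≡prefix-difference y i⁺ i⁻ ⟩
        Y (i⁻ + + 1) - Y i⁺       ≡⟨ cong (_- Y i⁺) (prefix-step y y⁻) ⟩
        Y i⁻ - + 1 - Y i⁺         ≡⟨ regroup (Y i⁻) (Y i⁺) ⟩
        - (- Y i⁻ - - Y i⁺) - + 1 ≡⟨ cong (λ g → - g - + 1) (trans gap (mirror-R (X t⁺) (X t⁻))) ⟩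
        - R - + 1                 ∎
        where
        open ≡-Reasoning
        regroup : ∀ a b → a - + 1 - b ≡ - (- a - - b) - + 1
        regroup = solve-∀
      overflowing : NegOverflowing N x y i⁺ i⁻
      overflowing r isR = subst (_< - r) (sym whole)
                            (ℤₚ.<-≤-trans (i-1<i (- R)) (ℤₚ.neg-mono-≤ (r≤oscillation isR)))
      minimal : ∀ c d → i⁺ < c → c ≤ d → d < i⁻ → ¬ NegOverflowing N x y c d
      minimal c d i⁺<c c≤d d<i⁻ overflow =
        ℤₚ.<⇒≱ (subst (_< - R) (Σ≡prefix-difference y c d) (overflow R (oscillation-isR periodic)))
               (subst (- R ≤_) (flip (Y c) (Y (d + + 1)))
                 (ℤₚ.neg-mono-≤ (subst (_ ≤_) (mirror-R (X t⁺) (X t⁻))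
                   (inner c d i⁺<c c≤d d<i⁻))))
        where flip : ∀ a b → - (- b - - a) ≡ b - a
              flip = solve-∀

  in-window : ∀ l k → k ℕ.< N → l < l + + 1 + + k × l + + 1 + + k ≤ l + + N
  in-window l k k<N = ℤₚ.<-≤-trans (i<i+1 l) (i≤i+n (l + + 1) k) ,
                      subst (_≤ l + + N) (sym (ℤₚ.+-assoc l (+ 1) (+ k))) (ℤₚ.+-monoʳ-≤ l (+≤+ k<N))

  module LiftedLoop (v₀ : Vertex N) (m₀ : Move) (ms : List Move)
                    (is-valid : ValidWalk N x y v₀ (m₀ ∷ ms)) (is-closed : endpoint N v₀ (m₀ ∷ ms) ≡ v₀)
                    (alternating : CyclicAlternating N (m₀ ∷ ms)) {m M : ℤ}
                    (bounded : All (λ v → m ≤ proj₁ v × proj₁ v ≤ M) (vertices N v₀ (m₀ ∷ ms))) where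

    p₀ : Point
    p₀ = proj₁ v₀ , + toℕ (proj₂ v₀)

    project-p₀ : project p₀ ≡ v₀
    project-p₀ = cong (λ j → proj₁ v₀ , j) (toZN-toℕ (proj₂ v₀))

    walk : List (Point × Move)
    walk = steps p₀ (m₀ ∷ ms)

    C : ℤ
    C = level (p₀ , m₀)

    legal : All Legal walk
    legal = legal-lift p₀ (m₀ ∷ ms) (subst (λ v → ValidWalk N x y v (m₀ ∷ ms)) (sym project-p₀) is-valid)

    on-level : All (λ s → level s ≡ C) walk
    on-level = level-along p₀ m₀ ms m₀ legal alternating

    in-strip : All (λ s → m ≤ column (proj₁ s) × column (proj₁ s) ≤ M) walk
    in-strip = map⁻ (subst (All _) (trans (cong (λ v → vertices N v (m₀ ∷ ms)) (sym project-p₀))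
                                          (vertices-project p₀ (m₀ ∷ ms))) bounded)

    returns : project (final p₀ (m₀ ∷ ms)) ≡ v₀
    returns = trans (sym (endpoint-project p₀ (m₀ ∷ ms)))
                    (trans (cong (λ v → endpoint N v (m₀ ∷ ms)) project-p₀) is-closed)

    final≡ : final p₀ (m₀ ∷ ms) ≡ (proj₁ v₀ , row p₀ + Δy N (m₀ ∷ ms))
    final≡ = cong₂ _,_ (cong proj₁ returns) (row-final p₀ (m₀ ∷ ms))

    level-repeats : level ((proj₁ v₀ , row p₀ + Δy N (m₀ ∷ ms)) , m₀) ≡ C
    level-repeats = subst (λ p → level (p , m₀) ≡ C) final≡
      (level-closing p₀ m₀ ms m₀ legal alternating
        (legal-project _ m₀ (subst (λ v → Allowed N x y v m₀) (sym returns) (proj₁ is-valid))))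

    record VerticalCrossing (d : Sign) (t : ℤ) : Set where
      field
        col      : ℤ
        visited  : Any (λ s → column (proj₁ s) ≡ col) walk
        oriented : y col ≡ d
        levelled : verticalLevel col t ≡ C
        inside   : m ≤ col × col ≤ M
    open VerticalCrossing

    upward-crossing : ∀ t → row p₀ < t → t ≤ row (final p₀ (m₀ ∷ ms)) → VerticalCrossing pos t
    upward-crossing t below above with crosses-row-upwards p₀ (m₀ ∷ ms) t below above
    ... | (i , l) , l+1≡t , step∈ = record
      { col      = i
      ; visited  = lose step∈ refl
      ; oriented = All.lookup legal step∈
      ; levelled = subst (λ u → verticalLevel i u ≡ C) l+1≡t (All.lookup on-level step∈)
      ; inside   = All.lookup in-strip step∈
      }

    downward-crossing : ∀ t → row (final p₀ (m₀ ∷ ms)) < t → t ≤ row p₀ → VerticalCrossing neg t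
    downward-crossing t below above with crosses-row-downwards p₀ (m₀ ∷ ms) t below above
    ... | (i , l) , l≡t , step∈ = record
      { col      = i
      ; visited  = lose step∈ refl
      ; oriented = All.lookup legal step∈
      ; levelled = subst (λ u → verticalLevel i u ≡ C) l≡t (All.lookup on-level step∈)
      ; inside   = All.lookup in-strip step∈
      }

    column-crossed : ∀ {i j} → Any (λ s → column (proj₁ s) ≡ i) walk →
                     Any (λ s → column (proj₁ s) ≡ j) walk → ∀ c → i ≤ c → c < j → ∃[ l ] horizontalLevel (c + + 1) l ≡ C
    column-crossed at-i at-j c i≤c c<j
      with crosses-column p₀ (m₀ ∷ ms) c (Any.map (λ e → subst (_≤ c) (sym e) i≤c) at-i)
                                          (Any.map (λ e → subst (c <_) (sym e) c<j) at-j)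
    ... | l , inj₁ step∈ = l , All.lookup on-level step∈
    ... | l , inj₂ step∈ = l , All.lookup on-level step∈

    crossed-between : ∀ {d d' t t'} (a : VerticalCrossing d t) (b : VerticalCrossing d' t') →
                      ∀ c → Between (col a) (col b) c → ∃[ l ] horizontalLevel (c + + 1) l ≡ C
    crossed-between a b c (inj₁ (a≤c , c<b)) = column-crossed (visited a) (visited b) c a≤c c<b
    crossed-between a b c (inj₂ (b≤c , c<a)) = column-crossed (visited b) (visited a) c b≤c c<a

    periodic-if-rise : Δy N (m₀ ∷ ms) ≡ + N → ∀ t → X (t + + N) ≡ X t
    periodic-if-rise Δy≡N =
      periodic-if-level-repeats (proj₁ v₀) (row p₀) m₀
        (subst (λ δ → level ((proj₁ v₀ , row p₀ + δ) , m₀) ≡ C) Δy≡N level-repeats)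

    periodic-if-fall : Δy N (m₀ ∷ ms) ≡ - + N → ∀ t → X (t + + N) ≡ X t
    periodic-if-fall Δy≡-N = periodic-if-level-repeats (proj₁ v₀) (row p₀ - + N) m₀ (trans
      (cong (λ r → level ((proj₁ v₀ , r) , m₀)) (i-j+j≡i (row p₀) (+ N)))
      (sym (subst (λ δ → level ((proj₁ v₀ , row p₀ + δ) , m₀) ≡ C) Δy≡-N level-repeats)))

    positive : Δy N (m₀ ∷ ms) ≡ + N →
               ∃[ m' ] ∃[ M' ] (m ≤ m' × m' < M' × M' ≤ M × MinPosOverflowing N x y m' M')
    positive Δy≡N
      with Periodic.maximum-in-window X (periodic-if-rise Δy≡N) (row p₀ + + 1)
         | Periodic.minimum-in-window X (periodic-if-rise Δy≡N) (row p₀ + + 1)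
    ... | k⁺ , k⁺<N , ≤max | k⁻ , k⁻<N , min≤ =
      col c⁻ , col c⁺ , proj₁ (inside c⁻) , proj₁ overflow , proj₂ (inside c⁺) , proj₂ overflow
      where
      crossing : ∀ {k} → k ℕ.< N → VerticalCrossing pos (row p₀ + + 1 + + k)
      crossing {k} k<N = upward-crossing _ (proj₁ (in-window (row p₀) k k<N))
        (subst (_ ≤_) (sym (trans (row-final p₀ (m₀ ∷ ms)) (cong (λ δ → row p₀ + δ) Δy≡N)))
               (proj₂ (in-window (row p₀) k k<N)))
      c⁺ = crossing k⁺<N
      c⁻ = crossing k⁻<N
      overflow = minimal-positive-overflow (row p₀ + + 1 + + k⁺) (row p₀ + + 1 + + k⁻)
                   ≤max min≤ (periodic-if-rise Δy≡N) (oriented c⁺) (oriented c⁻)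
                   (levelled c⁺) (levelled c⁻) (crossed-between c⁻ c⁺)

    negative : Δy N (m₀ ∷ ms) ≡ - + N →
               ∃[ m' ] ∃[ M' ] (m ≤ m' × m' < M' × M' ≤ M × MinNegOverflowing N x y m' M')
    negative Δy≡-N
      with Periodic.maximum-in-window X (periodic-if-fall Δy≡-N) (row p₀ - + N + + 1)
         | Periodic.minimum-in-window X (periodic-if-fall Δy≡-N) (row p₀ - + N + + 1)
    ... | k⁺ , k⁺<N , ≤max | k⁻ , k⁻<N , min≤ =
      col c⁺ , col c⁻ , proj₁ (inside c⁺) , proj₁ overflow , proj₂ (inside c⁻) , proj₂ overflow
      where
      crossing : ∀ {k} → k ℕ.< N → VerticalCrossing neg (row p₀ - + N + + 1 + + k)
      crossing {k} k<N = downward-crossing _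
        (subst (_< _) (sym (trans (row-final p₀ (m₀ ∷ ms)) (cong (λ δ → row p₀ + δ) Δy≡-N)))
               (proj₁ (in-window (row p₀ - + N) k k<N)))
        (subst (row p₀ - + N + + 1 + + k ≤_) (i-j+j≡i (row p₀) (+ N)) (proj₂ (in-window (row p₀ - + N) k k<N)))
      c⁺ = crossing k⁺<N
      c⁻ = crossing k⁻<N
      overflow = minimal-negative-overflow (row p₀ - + N + + 1 + + k⁺) (row p₀ - + N + + 1 + + k⁻)
                   ≤max min≤ (periodic-if-fall Δy≡-N) (oriented c⁺) (oriented c⁻)
                   (levelled c⁺) (levelled c⁻) (crossed-between c⁺ c⁻)

  loop-overflows :
    ∀ v₀ ms → ValidWalk N x y v₀ ms → endpoint N v₀ ms ≡ v₀ → CyclicAlternating N ms →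
    ∀ {m M} → All (λ v → m ≤ proj₁ v × proj₁ v ≤ M) (vertices N v₀ ms) →
    (Δy N ms ≡ + N → ∃[ m' ] ∃[ M' ] (m ≤ m' × m' < M' × M' ≤ M × MinPosOverflowing N x y m' M')) ×
    (Δy N ms ≡ - (+ N) → ∃[ m' ] ∃[ M' ] (m ≤ m' × m' < M' × M' ≤ M × MinNegOverflowing N x y m' M'))
  loop-overflows v₀ []        _        _         ()
  loop-overflows v₀ (m₀ ∷ ms) is-valid is-closed alternating bounded = positive , negative
    where open LiftedLoop v₀ m₀ ms is-valid is-closed alternating bounded

proposition3p2 :
    (N : ℕ) .{{_ : NonZero N}} (x : Fin N → Sign) (y : ℤ → Sign) →
    totalSum N x ≡ + 0 →
    (L : HitomezashiLoop N x y) (m M : ℤ) → BoundingCylinder N L m M →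
    (Δy N (moves L) ≡ + N →
      ∃[ m' ] ∃[ M' ] (m ≤ m' × m' < M' × M' ≤ M × MinPosOverflowing N x y m' M'))
    × (Δy N (moves L) ≡ - (+ N) →
      ∃[ m' ] ∃[ M' ] (m ≤ m' × m' < M' × M' ≤ M × MinNegOverflowing N x y m' M'))
proposition3p2 N x y _ L m M (bounded , _ , _) =
  Lift.loop-overflows N x y (start L) (moves L) (valid L) (closed L) (alter L) bounded
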